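{- Let $G=(V,E)$ be a graph. Then for every maximal interval-order subgraph $H$ of $\overline{L(G)}$ there exists a permutation $\pi$ of $V$ such that $H=\overline{L(G)}^{\sigma}$ for all $\sigma\in\Sigma(\pi)$.
   Context: Graphs are finite and simple. $L(G)$ is the line graph of $G$ (vertex set $E$, two edges adjacent iff they share an endpoint) and $\overline{L(G)}$ its complement. An interval-order graph is the complement of an interval graph (intersection graph of finitely many closed real intervals); a maximal interval-order subgraph of a graph $X$ is a graph $(V(X),F)$, $F\subseteq E(X)$, which is an interval-order graph with $F$ inclusion-wise maximal among such. For a graph $X$ and an ordering $\sigma=(x_1,\dots,x_m)$ of $V(X)$: $V_0:=V(X)$, $V_i:=V_{i-1}\cap N_X(x_i)$, $E_i$ is the set of edges from $x_i$ to $V_i$, and $X^\sigma:=(V(X),E_1\cup\dots\cup E_m)$. For a permutation (bijection) $\pi:V\to[n]$, $\Sigma(\pi)$ is the set of orderings $\sigma$ of $E$ such that an edge $uv$ precedes an edge $wz$ whenever $\max\{\pi(u),\pi(v)\}<\max\{\pi(w),\pi(z)\}$, edges with the same value of $\max\{\pi(\cdot),\pi(\cdot)\}$ appearing in arbitrary relative order.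
   Formalization: The closed intervals defining interval graphs, and hence interval-order graphs and maximal interval-order subgraphs, have rational endpoints rather than real ones. -}

module Defs where

open import Data.Bool using (Bool; T)
open import Data.Nat using (ℕ; _⊔_) renaming (_<_ to _<ℕ_; _≤_ to _≤ℕ_)
open import Data.Fin using (Fin; toℕ) renaming (_<_ to _<ᶠ_; _≤_ to _≤ᶠ_)
open import Data.Product using (Σ; _×_; _,_; proj₁; proj₂)
open import Data.Sum using (_⊎_)
open import Data.Rational using (ℚ) renaming (_≤_ to _≤ℚ_)
open import Relation.Nullary using (¬_)
open import Relation.Binary.PropositionalEquality using (_≡_; _≢_)
open import Function.Bundles using (_↔_; Inverse; _⇔_)

record SimpleGraph (n : ℕ) : Set where
  field
    adj    : Fin n → Fin n → Bool
    sym    : ∀ u v → adj u v ≡ adj v u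
    irrefl : ∀ u → adj u u ≡ Data.Bool.false

open SimpleGraph public

-- An edge {u,v} of G, stored with u < v (so each edge appears once).
record Edge {n : ℕ} (G : SimpleGraph n) : Set where
  constructor edge
  field
    u      : Fin n
    v      : Fin n
    u<v    : u <ᶠ v
    isEdge : T (adj G u v)

open Edge public

ShareEndpoint : ∀ {n} {G : SimpleGraph n} → Edge G → Edge G → Set
ShareEndpoint e f =
  (u e ≡ u f) ⊎ (u e ≡ v f) ⊎ (v e ≡ u f) ⊎ (v e ≡ v f)

LineAdj : ∀ {n} (G : SimpleGraph n) → Edge G → Edge G → Set
LineAdj G e f = e ≢ f × ShareEndpoint e f

CoLineAdj : ∀ {n} (G : SimpleGraph n) → Edge G → Edge G → Set
CoLineAdj G e f = e ≢ f × ¬ LineAdj G e f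

IsSpanningSubgraph : ∀ {A : Set} → (A → A → Set) → (A → A → Set) → Set
IsSpanningSubgraph {A} H X =
  (∀ a b → H a b → H b a) × (∀ a b → H a b → X a b)

SameGraph : ∀ {A : Set} → (A → A → Set) → (A → A → Set) → Set
SameGraph {A} H K = ∀ a b → H a b ⇔ K a b

record Interval : Set where
  constructor [_,_]⟨_⟩
  field
    lo    : ℚ
    hi    : ℚ
    lo≤hi : lo ≤ℚ hi

open Interval public

_∈I_ : ℚ → Interval → Set
x ∈I I = (lo I ≤ℚ x) × (x ≤ℚ hi I)

Intersect : Interval → Interval → Set
Intersect I J = Σ ℚ λ x → (x ∈I I) × (x ∈I J)

IsIntervalGraph : ∀ {A : Set} → (A → A → Set) → Set
IsIntervalGraph {A} X =
  Σ (A → Interval) λ I → ∀ a b → a ≢ b → (X a b ⇔ Intersect (I a) (I b))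

Complement : ∀ {A : Set} → (A → A → Set) → (A → A → Set)
Complement X a b = a ≢ b × ¬ X a b

IsIntervalOrderGraph : ∀ {A : Set} → (A → A → Set) → Set₁
IsIntervalOrderGraph {A} H =
  Σ (A → A → Set) λ K → IsIntervalGraph K × SameGraph H (Complement K)

IsMaximalIntervalOrderSubgraph :
  ∀ {A : Set} → (A → A → Set) → (A → A → Set) → Set₁
IsMaximalIntervalOrderSubgraph {A} H X =
  IsSpanningSubgraph H X × IsIntervalOrderGraph H ×
  (∀ (H' : A → A → Set) → IsSpanningSubgraph H' X → IsIntervalOrderGraph H' →
     (∀ a b → H a b → H' a b) → ∀ a b → H' a b → H a b)

-- An ordering σ = (x_0, …, x_{m-1}) of A: a bijection Fin m ↔ A.
-- (Inverse.to σ i) is x_i, (Inverse.from σ a) is the position of a.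
record Ordering (A : Set) : Set where
  constructor ordering
  field
    len : ℕ
    bij : Fin len ↔ A

  pos : A → Fin len
  pos = Inverse.from bij

open Ordering public

-- b ∈ V_i  (0-indexed):  b is adjacent to every x_j with j ≤ i.
InV : ∀ {A : Set} (X : A → A → Set) (σ : Ordering A) → Fin (len σ) → A → Set
InV {A} X σ i b = ∀ (w : A) → pos σ w ≤ᶠ i → X w b

-- X^σ: edge set E_1 ∪ … ∪ E_m, E_i = edges from x_i to V_i.
_^_ : ∀ {A : Set} → (A → A → Set) → Ordering A → (A → A → Set)
(X ^ σ) a b = InV X σ (pos σ a) b ⊎ InV X σ (pos σ b) a

Permutation : ℕ → Set
Permutation n = Fin n ↔ Fin n

maxπ : ∀ {n} {G : SimpleGraph n} → Permutation n → Edge G → ℕ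
maxπ π e = toℕ (Inverse.to π (u e)) ⊔ toℕ (Inverse.to π (v e))

InΣ : ∀ {n} {G : SimpleGraph n} → Permutation n → Ordering (Edge G) → Set
InΣ {n} {G} π σ =
  ∀ (e f : Edge G) → maxπ π e <ℕ maxπ π f → pos σ e <ᶠ pos σ f

{-# OPTIONS --safe #-}

-- Write X for the complement of L(G) and let I be an interval representation of
-- H, so that ef ∈ H iff I e and I f are disjoint.  Two edges meeting at a vertex
-- s are not adjacent in X, hence not in H, so their intervals overlap; therefore
-- the key κ s = min {hi (I e) | e ∋ s} satisfies lo (I b) ≤ κ s ≤ hi (I b) for
-- every edge b at s.  Let π sort the vertices by κ.  If ef ∈ H with I e left of
-- I f, every endpoint of e has smaller key, hence smaller π, than every endpoint
-- of f; so under any σ ∈ Σ(π) the edge e precedes every edge meeting f, that is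
-- f ∈ V_e, and ef ∈ X^σ.  Conversely X^σ is always an interval-order subgraph of
-- X (vertex b gets the positions from its first non-neighbour up to itself), so
-- the maximality of H gives H = X^σ.

module Submission where

open import Defs
open import Data.Bool using (T)
open import Data.Bool.Properties using (T?; T-irrelevant)
open import Data.Empty using (⊥-elim)
open import Data.Fin as F using (Fin; toℕ; fromℕ<; inject; punchOut)
open import Data.Fin.Properties as FP
  using (any?; injective⇒≤; punchOut-injective; toℕ-fromℕ<; toℕ-inject; toℕ-injective;
         ¬∀⟶∃¬-smallest)
open import Data.Fin.Subset using (Subset; ∣_∣) renaming (_∈_ to _∈ₛ_; _⊂_ to _⊂ₛ_)
open import Data.Fin.Subset.Properties using (p⊂q⇒∣p∣<∣q∣; ∣⊤∣≡n; ⊆⊤; ∈⊤)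
open import Data.Integer using (+_; +≤+; +<+)
import Data.Integer.Properties as ℤP
import Data.List as List
open import Data.List.Relation.Unary.All.Properties using (tabulate⁺; tabulate⁻)
open import Data.Nat as ℕ using (ℕ)
import Data.Nat.Properties as ℕP
open import Data.Product using (Σ; ∃; _×_; _,_; proj₁; proj₂)
open import Data.Product.Relation.Binary.Lex.Strict using (×-Lex; ×-transitive; ×-compare)
open import Data.Rational using (ℚ; _≤_; _<_; _≤?_; *≤*; *<*)
open import Data.Rational.Literals using (fromℤ)
import Data.Rational.Properties as QP
open import Data.Sum as Sum using (_⊎_; inj₁; inj₂; swap)
open import Data.Sum.Function.Propositional using (_⊎-⇔_)
import Data.Vec as Vec
open import Data.Vec.Properties using (lookup∘tabulate; lookup⇒[]=; []=⇒lookup)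
open import Function using (_∘_; _on_; id)
open import Function.Bundles using (_⇔_; mk⇔; mk↔ₛ′; Inverse; Equivalence)
open import Function.Construct.Composition using (_⇔-∘_)
open import Function.Definitions using (Injective)
open import Relation.Binary using (Rel; Transitive; Trichotomous; tri<; tri≈; tri>; TotalOrder)
open import Relation.Binary.Construct.Add.Supremum.NonStrict _≤_
  using (_≤⁺_; _≤⊤⁺; [_]; ≤⁺-isTotalOrder-≡)
open import Relation.Binary.Construct.Add.Supremum.Strict _<_
  using (_<⁺_; [_]<⊤⁺; [_]; <⁺-trans; <⁺-cmp-≡)
open import Relation.Binary.Consequences using (tri⇒dec<; tri⇒irr)
open import Relation.Binary.PropositionalEquality as ≡
  using (_≡_; _≢_; refl; cong; subst; subst₂)
open import Relation.Nullary using (¬_; Dec; yes; no; does; contradiction)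
open import Relation.Nullary.Construct.Add.Supremum using (_⁺; [_]; ⊤⁺)
open import Relation.Nullary.Decidable using (dec-true; _⊎-dec_; _×-dec_; ¬?)

private
  <⇒≱ : ∀ {p q : ℚ} → p < q → ¬ q ≤ p
  <⇒≱ p<q q≤p = QP.<-irrefl refl (QP.<-≤-trans p<q q≤p)

Separated : Interval → Interval → Set
Separated I J = hi I < lo J ⊎ hi J < lo I

intersect⇒lo≤hi : ∀ {I J} → Intersect I J → lo J ≤ hi I
intersect⇒lo≤hi (_ , (_ , x≤hiI) , (loJ≤x , _)) = QP.≤-trans loJ≤x x≤hiI

intersect-sym : ∀ {I J} → Intersect I J → Intersect J I
intersect-sym (x , x∈I , x∈J) = x , x∈J , x∈I

overlapping⇒intersect : ∀ {I J} → lo J ≤ hi I → lo I ≤ hi J → Intersect I J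
overlapping⇒intersect {I} {J} loJ≤hiI loI≤hiJ with QP.≤-total (lo I) (lo J)
... | inj₁ loI≤loJ = lo J , (loI≤loJ , loJ≤hiI) , (QP.≤-refl , lo≤hi J)
... | inj₂ loJ≤loI = lo I , (QP.≤-refl , lo≤hi I) , (loJ≤loI , loI≤hiJ)

separated⇒disjoint : ∀ {I J} → Separated I J → ¬ Intersect I J
separated⇒disjoint {I} {J} (inj₁ hiI<loJ) = <⇒≱ hiI<loJ ∘ intersect⇒lo≤hi {I} {J}
separated⇒disjoint {I} {J} (inj₂ hiJ<loI) =
  <⇒≱ hiJ<loI ∘ intersect⇒lo≤hi {J} {I} ∘ intersect-sym {I} {J}

disjoint⇒separated : ∀ {I J} → ¬ Intersect I J → Separated I J
disjoint⇒separated {I} {J} disjoint with lo J ≤? hi I | lo I ≤? hi J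
... | no loJ≰hiI | _          = inj₁ (QP.≰⇒> loJ≰hiI)
... | yes _      | no loI≰hiJ = inj₂ (QP.≰⇒> loI≰hiJ)
... | yes p      | yes q      = contradiction (overlapping⇒intersect {I} {J} p q) disjoint

separated-irrefl : ∀ I → ¬ Separated I I
separated-irrefl I = Sum.[ not-below , not-below ]
  where
  not-below : ¬ hi I < lo I
  not-below hi<lo = <⇒≱ hi<lo (lo≤hi I)

module _ {A : Set} {H : A → A → Set} where

  separation⇒isIntervalOrderGraph : (J : A → Interval) →
    (∀ a b → H a b ⇔ Separated (J a) (J b)) → IsIntervalOrderGraph H
  separation⇒isIntervalOrderGraph J H⇔separated =
    K , (J , λ _ _ _ → mk⇔ id id) , λ a b → mk⇔ (to a b) (from a b)
    where
    K : A → A → Set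
    K a b = Intersect (J a) (J b)

    to : ∀ a b → H a b → Complement K a b
    to a b h = (λ { refl → separated-irrefl (J a) sep }) , separated⇒disjoint {J a} {J b} sep
      where sep = Equivalence.to (H⇔separated a b) h

    from : ∀ a b → Complement K a b → H a b
    from a b (_ , disjoint) =
      Equivalence.from (H⇔separated a b) (disjoint⇒separated {J a} {J b} disjoint)

  module IntervalOrder (io : IsIntervalOrderGraph H) where

    interval : A → Interval
    interval = proj₁ (proj₁ (proj₂ io))

    private
      represents : ∀ a b → a ≢ b → proj₁ io a b ⇔ Intersect (interval a) (interval b)
      represents = proj₂ (proj₁ (proj₂ io))

      complement : SameGraph H (Complement (proj₁ io))
      complement = proj₂ (proj₂ io)

    adjacent⇒separated : ∀ {a b} → H a b → Separated (interval a) (interval b)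
    adjacent⇒separated {a} {b} h with Equivalence.to (complement a b) h
    ... | a≢b , ¬K =
      disjoint⇒separated {interval a} {interval b} (¬K ∘ Equivalence.from (represents a b a≢b))

    nonadjacent⇒lo≤hi : ∀ {a b} → a ≢ b → ¬ H a b → lo (interval b) ≤ hi (interval a)
    nonadjacent⇒lo≤hi {a} {b} a≢b ¬h = QP.≮⇒≥ λ hi<lo → ¬h (Equivalence.from (complement a b)
      (a≢b , separated⇒disjoint {interval a} {interval b} (inj₁ hi<lo)
               ∘ Equivalence.to (represents a b a≢b)))

fromℕ : ℕ → ℚ
fromℕ k = fromℤ (+ k)

fromℕ-mono-≤ : ∀ {k m} → k ℕ.≤ m → fromℕ k ≤ fromℕ m
fromℕ-mono-≤ k≤m = *≤* (ℤP.*-monoʳ-≤-nonNeg (+ 1) (+≤+ k≤m))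

fromℕ-<-⇔ : ∀ {k m} → k ℕ.< m ⇔ fromℕ k < fromℕ m
fromℕ-<-⇔ = mk⇔ (λ k<m → *<* (ℤP.*-monoʳ-<-pos (+ 1) (+<+ k<m)))
                (λ { (*<* k<m) → ℤP.drop‿+<+ (ℤP.*-cancelʳ-<-nonNeg (+ 1) k<m) })

ℕ-interval : (l r : ℕ) → l ℕ.≤ r → Interval
ℕ-interval l r l≤r = [ fromℕ l , fromℕ r ]⟨ fromℕ-mono-≤ l≤r ⟩

module GreedySubgraph {A : Set} (X : A → A → Set) (X? : ∀ a b → Dec (X a b))
                      (X-irrefl : ∀ a → ¬ X a a) (σ : Ordering A) where

  private
    x : Fin (len σ) → A
    x = Inverse.to (bij σ)

    x-pos : ∀ a → x (pos σ a) ≡ a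
    x-pos = Inverse.strictlyInverseˡ (bij σ)

    pos-x : ∀ i → pos σ (x i) ≡ i
    pos-x = Inverse.strictlyInverseʳ (bij σ)

    -- b itself is a non-neighbour of b, so there is a first one.
    search : ∀ b → ∃ λ t → ¬ X (x t) b × ((j : F.Fin′ t) → X (x (inject j)) b)
    search b = ¬∀⟶∃¬-smallest (len σ) (λ j → X (x j) b) (λ j → X? (x j) b)
                 (λ all → X-irrefl b (subst (λ a → X a b) (x-pos b) (all (pos σ b))))

  firstNonNeighbour : A → Fin (len σ)
  firstNonNeighbour b = proj₁ (search b)

  private
    firstNonNeighbour-nonadjacent : ∀ b → ¬ X (x (firstNonNeighbour b)) b
    firstNonNeighbour-nonadjacent b = proj₁ (proj₂ (search b))

    <firstNonNeighbour⇒adjacent : ∀ {j b} → j F.< firstNonNeighbour b → X (x j) b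
    <firstNonNeighbour⇒adjacent {j} {b} j<t =
      subst (λ i → X (x i) b) inject-j′≡j (proj₂ (proj₂ (search b)) j′)
      where
      j′ = fromℕ< j<t
      inject-j′≡j : inject j′ ≡ j
      inject-j′≡j = toℕ-injective (≡.trans (toℕ-inject j′) (toℕ-fromℕ< j<t))

  inV⇔<firstNonNeighbour : ∀ {i b} → InV X σ i b ⇔ i F.< firstNonNeighbour b
  inV⇔<firstNonNeighbour {i} {b} = mk⇔ to from
    where
    to : InV X σ i b → i F.< firstNonNeighbour b
    to inV = ℕP.≰⇒> λ t≤i → firstNonNeighbour-nonadjacent b
               (inV _ (subst (F._≤ i) (≡.sym (pos-x _)) t≤i))

    from : i F.< firstNonNeighbour b → InV X σ i b
    from i<t w pos≤i = subst (λ a → X a b) (x-pos w)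
                         (<firstNonNeighbour⇒adjacent (ℕP.≤-<-trans pos≤i i<t))

  firstNonNeighbour≤pos : ∀ b → firstNonNeighbour b F.≤ pos σ b
  firstNonNeighbour≤pos b = ℕP.≮⇒≥ λ pos<t →
    X-irrefl b (subst (λ a → X a b) (x-pos b) (<firstNonNeighbour⇒adjacent pos<t))

  interval : A → Interval
  interval b =
    ℕ-interval (toℕ (firstNonNeighbour b)) (toℕ (pos σ b)) (firstNonNeighbour≤pos b)

  ^⇔separated : ∀ a b → (X ^ σ) a b ⇔ Separated (interval a) (interval b)
  ^⇔separated a b = (fromℕ-<-⇔ ⊎-⇔ fromℕ-<-⇔)
                 ⇔-∘ (inV⇔<firstNonNeighbour ⊎-⇔ inV⇔<firstNonNeighbour)

  ^-isIntervalOrderGraph : IsIntervalOrderGraph (X ^ σ)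
  ^-isIntervalOrderGraph = separation⇒isIntervalOrderGraph interval ^⇔separated

  ^-isSpanningSubgraph : (∀ a b → X a b → X b a) → IsSpanningSubgraph (X ^ σ) X
  ^-isSpanningSubgraph X-sym = (λ _ _ → swap) , λ a b →
    Sum.[ (λ inV → inV a ℕP.≤-refl) , (λ inV → X-sym b a (inV b ℕP.≤-refl)) ]

injective⇒surjective : ∀ {n} {f : Fin n → Fin n} →
                       Injective _≡_ _≡_ f → ∀ y → ∃ λ x → f x ≡ y
injective⇒surjective {ℕ.suc n} {f} f-injective y with any? (λ x → f x FP.≟ y)
... | yes hit = hit
... | no miss = contradiction (injective⇒≤ g-injective) ℕP.1+n≰n
  where
  y≢f : ∀ x → y ≢ f x
  y≢f x y≡fx = miss (x , ≡.sym y≡fx)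

  g : Fin (ℕ.suc n) → Fin n
  g x = punchOut (y≢f x)

  g-injective : Injective _≡_ _≡_ g
  g-injective gx≡gx′ = f-injective (punchOut-injective (y≢f _) (y≢f _) gx≡gx′)

injective⇒permutation : ∀ {n} (f : Fin n → Fin n) → Injective _≡_ _≡_ f → Permutation n
injective⇒permutation f f-injective = mk↔ₛ′ f (proj₁ ∘ surjective) (proj₂ ∘ surjective)
  (λ x → f-injective (proj₂ (surjective (f x))))
  where surjective = injective⇒surjective f-injective

module Ranking {n ℓ} {_⊏_ : Rel (Fin n) ℓ}
               (⊏-trans : Transitive _⊏_) (⊏-compare : Trichotomous _≡_ _⊏_) where

  private
    _⊏?_ : ∀ p s → Dec (p ⊏ s)
    _⊏?_ = tri⇒dec< ⊏-compare

    predecessors : Fin n → Subset n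
    predecessors s = Vec.tabulate (λ p → does (p ⊏? s))

    ∈-predecessors⁺ : ∀ {p s} → p ⊏ s → p ∈ₛ predecessors s
    ∈-predecessors⁺ {p} {s} p⊏s =
      lookup⇒[]= p _ (≡.trans (lookup∘tabulate _ p) (dec-true (p ⊏? s) p⊏s))

    ∈-predecessors⁻ : ∀ {p s} → p ∈ₛ predecessors s → p ⊏ s
    ∈-predecessors⁻ {p} {s} p∈
      with p ⊏? s | ≡.trans (≡.sym (lookup∘tabulate _ p)) ([]=⇒lookup p∈)
    ... | yes p⊏s | _  = p⊏s
    ... | no _    | ()

    ∉-predecessors : ∀ s → ¬ s ∈ₛ predecessors s
    ∉-predecessors s = tri⇒irr ⊏-compare refl ∘ ∈-predecessors⁻

    predecessors-mono : ∀ {p s} → p ⊏ s → predecessors p ⊂ₛ predecessors s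
    predecessors-mono {p} p⊏s =
      (λ q∈ → ∈-predecessors⁺ (⊏-trans (∈-predecessors⁻ q∈) p⊏s)) ,
      p , ∈-predecessors⁺ p⊏s , ∉-predecessors p

    rank< : ∀ s → ∣ predecessors s ∣ ℕ.< n
    rank< s = subst (∣ predecessors s ∣ ℕ.<_) (∣⊤∣≡n n)
                (p⊂q⇒∣p∣<∣q∣ (⊆⊤ , s , ∈⊤ , ∉-predecessors s))

  rank : Fin n → Fin n
  rank s = fromℕ< (rank< s)

  rank-mono : ∀ {p s} → p ⊏ s → rank p F.< rank s
  rank-mono {p} {s} p⊏s =
    subst₂ ℕ._<_ (≡.sym (toℕ-fromℕ< (rank< p))) (≡.sym (toℕ-fromℕ< (rank< s)))
      (p⊂q⇒∣p∣<∣q∣ (predecessors-mono p⊏s))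

  rank-injective : Injective _≡_ _≡_ rank
  rank-injective {p} {s} rank≡ with ⊏-compare p s
  ... | tri< p⊏s _ _ = contradiction (rank-mono p⊏s) (FP.<-irrefl rank≡)
  ... | tri≈ _ p≡s _ = p≡s
  ... | tri> _ _ s⊏p = contradiction (rank-mono s⊏p) (FP.<-irrefl (≡.sym rank≡))

  rankPermutation : Permutation n
  rankPermutation = injective⇒permutation rank rank-injective

module _ {a ℓ} {A : Set a} {_<ₐ_ : Rel A ℓ}
         (<ₐ-trans : Transitive _<ₐ_) (<ₐ-compare : Trichotomous _≡_ _<ₐ_) where

  sortingPermutation : ∀ {n} (κ : Fin n → A) →
    Σ (Permutation n) λ π → ∀ {p s} → κ p <ₐ κ s → Inverse.to π p F.< Inverse.to π s
  sortingPermutation {n} κ = rankPermutation , rank-mono ∘ inj₁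
    where
    _⊏_ : Rel (Fin n) _
    _⊏_ = ×-Lex _≡_ _<ₐ_ F._<_ on λ p → κ p , p

    ⊏-trans : Transitive _⊏_
    ⊏-trans = ×-transitive {_<₂_ = F._<_} ≡.isEquivalence (≡.resp₂ _<ₐ_) <ₐ-trans FP.<-trans

    ⊏-compare : Trichotomous _≡_ _⊏_
    ⊏-compare p s with ×-compare ≡.sym <ₐ-compare FP.<-cmp (κ p , p) (κ s , s)
    ... | tri< p⊏s p≉s s⊏̸p       = tri< p⊏s (λ { refl → p≉s (refl , refl) }) s⊏̸p
    ... | tri≈ p⊏̸s (_ , p≡s) s⊏̸p = tri≈ p⊏̸s p≡s s⊏̸p
    ... | tri> p⊏̸s p≉s s⊏p       = tri> p⊏̸s (λ { refl → p≉s (refl , refl) }) s⊏p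

    open Ranking ⊏-trans ⊏-compare

module LineGraph {n} (G : SimpleGraph n) where

  data Endpoint : Fin n → Edge G → Set where
    first  : ∀ {e} → Endpoint (u e) e
    second : ∀ {e} → Endpoint (v e) e

  common-endpoint⇒shareEndpoint : ∀ {s} {e f : Edge G} →
                                  Endpoint s e → Endpoint s f → ShareEndpoint e f
  common-endpoint⇒shareEndpoint first  first  = inj₁ refl
  common-endpoint⇒shareEndpoint first  second = inj₂ (inj₁ refl)
  common-endpoint⇒shareEndpoint second first  = inj₂ (inj₂ (inj₁ refl))
  common-endpoint⇒shareEndpoint second second = inj₂ (inj₂ (inj₂ refl))

  shareEndpoint⇒common-endpoint : ∀ (e f : Edge G) → ShareEndpoint e f →
                                  ∃ λ s → Endpoint s e × Endpoint s f
  shareEndpoint⇒common-endpoint e f (inj₁ refl)               = u e , first , first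
  shareEndpoint⇒common-endpoint e f (inj₂ (inj₁ refl))        = u e , first , second
  shareEndpoint⇒common-endpoint e f (inj₂ (inj₂ (inj₁ refl))) = v e , second , first
  shareEndpoint⇒common-endpoint e f (inj₂ (inj₂ (inj₂ refl))) = v e , second , second

  shareEndpoint-sym : ∀ (e f : Edge G) → ShareEndpoint e f → ShareEndpoint f e
  shareEndpoint-sym e f share with _ , se , sf ← shareEndpoint⇒common-endpoint e f share =
    common-endpoint⇒shareEndpoint sf se

  shareEndpoint? : ∀ (e f : Edge G) → Dec (ShareEndpoint e f)
  shareEndpoint? e f =
    (u e FP.≟ u f) ⊎-dec (u e FP.≟ v f) ⊎-dec (v e FP.≟ u f) ⊎-dec (v e FP.≟ v f)

  edge-≡ : ∀ {e f : Edge G} → u e ≡ u f → v e ≡ v f → e ≡ f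
  edge-≡ {edge _ _ ue<ve e∈G} {edge _ _ uf<vf f∈G} refl refl =
    ≡.cong₂ (edge _ _) (FP.<-irrelevant ue<ve uf<vf) (T-irrelevant e∈G f∈G)

  _≟ₑ_ : ∀ (e f : Edge G) → Dec (e ≡ f)
  e ≟ₑ f with u e FP.≟ u f | v e FP.≟ v f
  ... | yes ue≡uf | yes ve≡vf = yes (edge-≡ ue≡uf ve≡vf)
  ... | no ue≢uf  | _         = no (ue≢uf ∘ cong u)
  ... | _         | no ve≢vf  = no (ve≢vf ∘ cong v)

  coLineAdj? : ∀ (e f : Edge G) → Dec (CoLineAdj G e f)
  coLineAdj? e f = ¬? (e ≟ₑ f) ×-dec ¬? (¬? (e ≟ₑ f) ×-dec shareEndpoint? e f)

  coLineAdj-sym : ∀ (e f : Edge G) → CoLineAdj G e f → CoLineAdj G f e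
  coLineAdj-sym e f (e≢f , ¬lineAdj) =
    e≢f ∘ ≡.sym , λ (_ , share) → ¬lineAdj (e≢f , shareEndpoint-sym f e share)

  coLineAdj-irrefl : ∀ (e : Edge G) → ¬ CoLineAdj G e e
  coLineAdj-irrefl e (e≢e , _) = e≢e refl

  ¬shareEndpoint⇒coLineAdj : ∀ (e f : Edge G) → ¬ ShareEndpoint e f → CoLineAdj G e f
  ¬shareEndpoint⇒coLineAdj e f ¬share = (λ { refl → ¬share (inj₁ refl) }) , ¬share ∘ proj₂

  edgeBetween : ∀ a b → T (adj G a b) → Edge G
  edgeBetween a b ab with FP.<-cmp a b
  ... | tri< a<b _ _  = edge a b a<b ab
  ... | tri≈ _ refl _ = ⊥-elim (subst T (irrefl G a) ab)
  ... | tri> _ _ b<a  = edge b a b<a (subst T (SimpleGraph.sym G a b) ab)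

  edgeBetween-endpoint : ∀ {a b} (ab : T (adj G a b)) → Endpoint a (edgeBetween a b ab)
  edgeBetween-endpoint {a} {b} ab with FP.<-cmp a b
  ... | tri< _ _ _    = first
  ... | tri≈ _ refl _ = ⊥-elim (subst T (irrefl G a) ab)
  ... | tri> _ _ _    = second

  endpoint⇒edgeBetween : ∀ {s} {e : Edge G} → Endpoint s e →
                         ∃ λ y → Σ (T (adj G s y)) λ sy → edgeBetween s y sy ≡ e
  endpoint⇒edgeBetween {e = e} first = v e , isEdge e , uv
    where
    uv : edgeBetween (u e) (v e) (isEdge e) ≡ e
    uv with FP.<-cmp (u e) (v e)
    ... | tri< _ _ _     = edge-≡ refl refl
    ... | tri≈ ue≮ve _ _ = contradiction (u<v e) ue≮ve
    ... | tri> ue≮ve _ _ = contradiction (u<v e) ue≮ve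
  endpoint⇒edgeBetween {e = e} second = u e , ve∈G , vu
    where
    ve∈G = subst T (SimpleGraph.sym G (u e) (v e)) (isEdge e)
    vu : edgeBetween (v e) (u e) ve∈G ≡ e
    vu with FP.<-cmp (v e) (u e)
    ... | tri< ve<ue _ _ = contradiction (u<v e) (ℕP.<-asym ve<ue)
    ... | tri≈ _ ve≡ue _ = contradiction (u<v e) (FP.<-irrefl (≡.sym ve≡ue))
    ... | tri> _ _ _     = edge-≡ refl refl

  endpoint≤maxπ : ∀ (π : Permutation n) {s} {e : Edge G} →
                  Endpoint s e → toℕ (Inverse.to π s) ℕ.≤ maxπ π e
  endpoint≤maxπ π first  = ℕP.m≤m⊔n _ _
  endpoint≤maxπ π second = ℕP.m≤n⊔m _ _

  maxπ<-lub : ∀ (π : Permutation n) {i : Fin n} {e : Edge G} →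
              (∀ {p} → Endpoint p e → Inverse.to π p F.< i) → maxπ π e ℕ.< toℕ i
  maxπ<-lub π below = ℕP.⊔-lub (below first) (below second)

≤⁺-totalOrder : TotalOrder _ _ _
≤⁺-totalOrder = record { isTotalOrder = ≤⁺-isTotalOrder-≡ QP.≤-isTotalOrder }

open import Data.List.Extrema ≤⁺-totalOrder using (min; min≤xs; v≤min⁺)

≤⁺-<-≤⁺-trans : ∀ {x y h l} → x ≤⁺ [ h ] → h < l → [ l ] ≤⁺ y → x <⁺ y
≤⁺-<-≤⁺-trans [ x≤h ] h<l [ l≤y ] = [ QP.≤-<-trans x≤h (QP.<-≤-trans h<l l≤y) ]
≤⁺-<-≤⁺-trans {[ x ]} [ x≤h ] h<l (_ ≤⊤⁺) = [ x ]<⊤⁺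

module MaximalSubgraph {n} {G : SimpleGraph n} {H : Edge G → Edge G → Set}
                       (maximal : IsMaximalIntervalOrderSubgraph H (CoLineAdj G)) where

  open LineGraph G
  open IntervalOrder (proj₁ (proj₂ maximal))

  private
    H⊆coLineAdj : ∀ e f → H e f → CoLineAdj G e f
    H⊆coLineAdj = proj₂ (proj₁ maximal)

  common-endpoint⇒lo≤hi : ∀ {s} {e f : Edge G} →
                          Endpoint s e → Endpoint s f → lo (interval f) ≤ hi (interval e)
  common-endpoint⇒lo≤hi {e = e} {f} se sf with e ≟ₑ f
  ... | yes refl = lo≤hi (interval e)
  ... | no e≢f   = nonadjacent⇒lo≤hi e≢f λ h →
    proj₂ (H⊆coLineAdj e f h) (e≢f , common-endpoint⇒shareEndpoint se sf)

  -- ⊤⁺ stands in for the right endpoint of a missing edge, so that an isolated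
  -- vertex still has a key.
  hiAt : Fin n → Fin n → ℚ ⁺
  hiAt s y with T? (adj G s y)
  ... | yes sy = [ hi (interval (edgeBetween s y sy)) ]
  ... | no _   = ⊤⁺

  hiAt-edgeBetween : ∀ {s y} (sy : T (adj G s y)) →
                     hiAt s y ≡ [ hi (interval (edgeBetween s y sy)) ]
  hiAt-edgeBetween {s} {y} sy with T? (adj G s y)
  ... | yes sy′ = cong (λ t → [ hi (interval (edgeBetween s y t)) ]) (T-irrelevant sy′ sy)
  ... | no ¬sy  = contradiction sy ¬sy

  key : Fin n → ℚ ⁺
  key s = min ⊤⁺ (List.tabulate (hiAt s))

  key≤hi : ∀ {s} {e : Edge G} → Endpoint s e → key s ≤⁺ [ hi (interval e) ]
  key≤hi {s} se with y , sy , refl ← endpoint⇒edgeBetween se =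
    subst (key s ≤⁺_) (hiAt-edgeBetween sy) (tabulate⁻ (min≤xs ⊤⁺ (List.tabulate (hiAt s))) y)

  lo≤key : ∀ {s} {b : Edge G} → Endpoint s b → [ lo (interval b) ] ≤⁺ key s
  lo≤key {s} {b} sb = v≤min⁺ (_ ≤⊤⁺) (tabulate⁺ lo≤hiAt)
    where
    lo≤hiAt : ∀ y → [ lo (interval b) ] ≤⁺ hiAt s y
    lo≤hiAt y with T? (adj G s y)
    ... | yes sy = [ common-endpoint⇒lo≤hi (edgeBetween-endpoint sy) sb ]
    ... | no _   = _ ≤⊤⁺

  private
    sorted = sortingPermutation (<⁺-trans QP.<-trans) (<⁺-cmp-≡ QP.<-cmp) key

  π : Permutation n
  π = proj₁ sorted

  separated⇒maxπ< : ∀ {a b} → hi (interval a) < lo (interval b) →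
                    ∀ w → ShareEndpoint w b → maxπ π a ℕ.< maxπ π w
  separated⇒maxπ< {a} {b} a<b w share
    with s , sw , sb ← shareEndpoint⇒common-endpoint w b share =
    ℕP.<-≤-trans (maxπ<-lub π λ pa → π-mono (≤⁺-<-≤⁺-trans (key≤hi pa) a<b (lo≤key sb)))
                 (endpoint≤maxπ π sw)
    where π-mono = proj₂ sorted

  module _ (σ : Ordering (Edge G)) (σ∈Σπ : InΣ π σ) where

    separated⇒inV : ∀ a b → hi (interval a) < lo (interval b) →
                    InV (CoLineAdj G) σ (pos σ a) b
    separated⇒inV a b a<b w pos-w≤pos-a = ¬shareEndpoint⇒coLineAdj w b λ share →
      ℕP.<⇒≱ (σ∈Σπ a w (separated⇒maxπ< a<b w share)) pos-w≤pos-a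

    H⊆^σ : ∀ a b → H a b → (CoLineAdj G ^ σ) a b
    H⊆^σ a b h = Sum.map (separated⇒inV a b) (separated⇒inV b a) (adjacent⇒separated h)

    ^σ⊆H : ∀ a b → (CoLineAdj G ^ σ) a b → H a b
    ^σ⊆H = proj₂ (proj₂ maximal) (CoLineAdj G ^ σ)
             (^-isSpanningSubgraph coLineAdj-sym) ^-isIntervalOrderGraph H⊆^σ
      where
      open GreedySubgraph (CoLineAdj G) coLineAdj? coLineAdj-irrefl σ
        using (^-isSpanningSubgraph; ^-isIntervalOrderGraph)

lemma12 : ∀ (n : ℕ) (G : SimpleGraph n) (H : Edge G → Edge G → Set) →
            IsMaximalIntervalOrderSubgraph H (CoLineAdj G) →
            Σ (Permutation n) λ π →
              ∀ (σ : Ordering (Edge G)) → InΣ π σ →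
                SameGraph H (CoLineAdj G ^ σ)
lemma12 n G H maximal = π , λ σ σ∈Σπ a b → mk⇔ (H⊆^σ σ σ∈Σπ a b) (^σ⊆H σ σ∈Σπ a b)
  where open MaximalSubgraph maximal
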